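{- Let $G$ be a connected graph of order $n$. (1) If $x$ is an edge not in $G$ joining two vertices of $G$, then $\chi_i'(G)\le \chi_i'(G+x)$. (2) If $G$ contains a cycle $C_p$ as a subgraph with $p\ge 4$ and $p\not\equiv 0 \pmod 4$, then $\chi_i'(G)\ge 3$. (3) If $G$ contains a complete graph $K_p$ as a subgraph, then $\chi_i'(G)\ge p(p-1)/2$. (4) If $G$ contains the tree $T'$ as a subgraph, then $\chi_i'(G)\ge 3$. (5) If $G$ is a tree containing $T'$ as a subgraph, then $\chi_i'(G)=3$.
   Context: All graphs are finite and simple; $G+x$ is the graph obtained from $G$ by adding the edge $x$. $T'$ is the tree on 8 vertices $a,b,c,d,e,f,g,h$ with edges $ab, bc, cd, de, ef, cg, dh$ (a path $a b c d e f$ with a pendant vertex attached to each of the two middle vertices $c$ and $d$). Three edges $e_1,e_2,e_3$ (in this order) are consecutive if $e_1=xy$, $e_2=yz$, $e_3=zu$ for some vertices $x,y,z,u$ (where $x=u$ is allowed). An injective edge coloring of $G$ is a map $c:E(G)\to\mathcal{C}$ such that whenever $e_1,e_2,e_3$ are consecutive edges, $c(e_1)\neq c(e_3)$. $\chi_i'(G)$ is the minimum number of colors in an injective edge coloring of $G$. -}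

module Defs where

open import Data.Nat using (ℕ; zero; suc; _+_; _*_; _∸_; _≤_; _≥_)
open import Data.Nat.DivMod using (_/_; _%_)
open import Data.Fin using (Fin; toℕ; fromℕ<; _≟_) renaming (zero to fz; suc to fs)
open import Data.Bool using (Bool; true; false; _∧_; _∨_)
open import Data.Bool.Properties using (∨-comm; ∧-comm; ∨-zeroʳ)
open import Data.Product using (Σ; _×_; _,_; ∃)
open import Relation.Nullary using (¬_; yes; no)
open import Relation.Nullary.Decidable using (⌊_⌋)
open import Relation.Binary.PropositionalEquality using (_≡_; _≢_; refl; cong; cong₂; sym; trans)
open import Function.Definitions using (Injective)
open import Data.Empty using (⊥-elim)

record Graph (n : ℕ) : Set where
  field
    adj    : Fin n → Fin n → Bool
    adj-sym    : ∀ u v → adj u v ≡ adj v u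
    adj-irrefl : ∀ u → adj u u ≡ false
open Graph public

E : ∀ {n} → Graph n → Fin n → Fin n → Set
E G u v = adj G u v ≡ true

data Reach {n} (G : Graph n) (u : Fin n) : Fin n → Set where
  here : Reach G u u
  step : ∀ {v w} → Reach G u v → E G v w → Reach G u w

Connected : ∀ {n} → Graph n → Set
Connected {n} G = ∀ (u v : Fin n) → Reach G u v

private
  isPair : ∀ {n} → Fin n → Fin n → Fin n → Fin n → Bool
  isPair a b u v = (⌊ u ≟ a ⌋ ∧ ⌊ v ≟ b ⌋) ∨ (⌊ u ≟ b ⌋ ∧ ⌊ v ≟ a ⌋)

  isPair-sym : ∀ {n} (a b u v : Fin n) → isPair a b u v ≡ isPair a b v u
  isPair-sym a b u v =
    trans (cong₂ _∨_ (∧-comm ⌊ u ≟ a ⌋ ⌊ v ≟ b ⌋) (∧-comm ⌊ u ≟ b ⌋ ⌊ v ≟ a ⌋))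
          (∨-comm (⌊ v ≟ b ⌋ ∧ ⌊ u ≟ a ⌋) (⌊ v ≟ a ⌋ ∧ ⌊ u ≟ b ⌋))

  isPair-irr : ∀ {n} (a b : Fin n) → a ≢ b → ∀ u → isPair a b u u ≡ false
  isPair-irr a b a≢b u with u ≟ a | u ≟ b
  ... | yes refl | yes refl = ⊥-elim (a≢b refl)
  ... | yes _ | no _ = refl
  ... | no _ | yes _ = refl
  ... | no _ | no _ = refl

_+edge_ : ∀ {n} (G : Graph n) → (Σ (Fin n × Fin n) λ { (a , b) → a ≢ b }) → Graph n
adj (G +edge ((a , b) , _)) u v = adj G u v ∨ isPair a b u v
adj-sym (G +edge ((a , b) , _)) u v = cong₂ _∨_ (adj-sym G u v) (isPair-sym a b u v)
adj-irrefl (G +edge ((a , b) , a≢b)) u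
  rewrite adj-irrefl G u = isPair-irr a b a≢b u

-- Injective edge colouring with colours Fin k: a colour c u v for each
-- (ordered) pair, required to be symmetric on edges (so it is a map on E(G)).
-- Consecutive edges xy, yz, zu are three distinct edges, i.e. x ≢ z and
-- y ≢ u (x = u allowed); they must satisfy c(xy) ≢ c(zu).
record InjEdgeColouring {n} (G : Graph n) (k : ℕ) : Set where
  field
    col     : Fin n → Fin n → Fin k
    col-sym : ∀ u v → E G u v → col u v ≡ col v u
    col-inj : ∀ x y z u → E G x y → E G y z → E G z u →
              x ≢ z → y ≢ u → col x y ≢ col z u

InjChromaticIndex : ∀ {n} → Graph n → ℕ → Set
InjChromaticIndex G k =
  InjEdgeColouring G k × (∀ m → InjEdgeColouring G m → k ≤ m)

sucMod : ∀ {p} → Fin p → Fin p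
sucMod {suc p} i = fromℕ< (Data.Nat.DivMod.m%n<n (suc (toℕ i)) (suc p))

ContainsCycle : ∀ {n} → Graph n → ℕ → Set
ContainsCycle {n} G p =
  Σ (Fin p → Fin n) λ f → Injective _≡_ _≡_ f × (∀ i → E G (f i) (f (sucMod i)))

ContainsComplete : ∀ {n} → Graph n → ℕ → Set
ContainsComplete {n} G p =
  Σ (Fin p → Fin n) λ f → Injective _≡_ _≡_ f × (∀ i j → i ≢ j → E G (f i) (f j))

ContainsT' : ∀ {n} → Graph n → Set
ContainsT' {n} G =
  Σ (Fin 8 → Fin n) λ f → Injective _≡_ _≡_ f ×
    (E G (f a) (f b) × E G (f b) (f c) × E G (f c) (f d) × E G (f d) (f e) ×
     E G (f e) (f f') × E G (f c) (f g) × E G (f d) (f h))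
  where
  a b c d e f' g h : Fin 8
  a = fz
  b = fs fz
  c = fs (fs fz)
  d = fs (fs (fs fz))
  e = fs (fs (fs (fs fz)))
  f' = fs (fs (fs (fs (fs fz))))
  g = fs (fs (fs (fs (fs (fs fz)))))
  h = fs (fs (fs (fs (fs (fs (fs fz))))))

IsTree : ∀ {n} → Graph n → Set
IsTree G = Connected G × (∀ p → p ≥ 3 → ¬ ContainsCycle G p)

module Submission where

-- * Monotonicity: an injective edge colouring of H restricts to every spanning
--   subgraph G ⊆ H, so χᵢ'(G) ≤ χᵢ'(H); in particular G ⊆ G + x.
-- * Two colours do not suffice for graphs containing T', nor for graphs
--   containing a cycle C_p with p ≥ 3 and 4 ∤ p: in T' the colours forced by
--   the outer edges clash, and around C_p the colours of edges two steps apart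
--   alternate, which closes up only when 4 ∣ p.  Hence χᵢ' ≥ 3 for these.
-- * In a clique K_p any two distinct edges are the outer edges of three
--   consecutive edges, so its p(p-1)/2 edges all receive distinct colours.
-- * Every tree has an injective edge colouring with 3 colours: colour each
--   edge by the breadth-first layer of its deeper end, mod 3.  In an acyclic
--   connected graph every edge joins consecutive layers and every vertex has a
--   unique neighbour in the layer above; otherwise the offending edge and two
--   root paths form a closed walk without backtracking, which contains a cycle.

open import Defs
open import Data.Nat using (ℕ; zero; suc; _+_; _*_; _∸_; _≤_; _<_; _≥_; _⊔_; _≤?_; _<?_; NonZero; z≤n; s≤s; s≤s⁻¹; z<s)
open import Data.Nat.Properties
open import Data.Nat.Induction using (<-rec)
open import Data.Nat.DivMod using (_%_; _/_; m%n<n; %-distribˡ-+; m%n%n≡m%n; m<n⇒m%n≡m; m≤n⇒[n∸m]%m≡n%m; [m+n]%n≡m%n; n%n≡0; m*n%n≡0; m*n/n≡m)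
open import Data.Fin using (Fin; #_; toℕ; fromℕ; fromℕ<; inject₁; inject≤; splitAt; join) renaming (zero to fz; suc to fs; _≟_ to _≟F_)
open import Data.Fin.Properties using (toℕ-injective; toℕ-fromℕ<; toℕ-fromℕ; toℕ-inject₁; toℕ<n; inject₁-injective; inject≤-injective; injective⇒≤; join-splitAt; any?)
open import Data.Bool using (true; false)
open import Data.Bool.Properties using () renaming (_≟_ to _≟B_)
open import Data.Product using (Σ; _×_; _,_; proj₁; proj₂)
open import Data.Sum using (_⊎_; inj₁; inj₂)
open import Data.Empty using (⊥; ⊥-elim)
open import Relation.Nullary using (¬_; yes; no; Dec)
open import Relation.Nullary.Decidable using (_×-dec_)
open import Relation.Binary using (tri<; tri≈; tri>)
open import Relation.Binary.PropositionalEquality using (_≡_; _≢_; refl; sym; trans; cong; cong₂; subst; subst₂; ≢-sym; module ≡-Reasoning)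
open import Function.Definitions using (Injective)

open InjEdgeColouring

E-sym : ∀ {n} {G : Graph n} {u v} → E G u v → E G v u
E-sym {G = G} {u} {v} uv = trans (adj-sym G v u) uv

adjacent⇒distinct : ∀ {n} {G : Graph n} {u v} → E G u v → u ≢ v
adjacent⇒distinct {G = G} {u} uv refl with trans (sym uv) (adj-irrefl G u)
... | ()

widen : ∀ {n} {G : Graph n} {k m} → k ≤ m → InjEdgeColouring G k → InjEdgeColouring G m
col (widen k≤m C) u v = inject≤ (col C u v) k≤m
col-sym (widen k≤m C) u v uv = cong (λ c → inject≤ c k≤m) (col-sym C u v uv)
col-inj (widen k≤m C) x y z u xy yz zu x≢z y≢u same =
  col-inj C x y z u xy yz zu x≢z y≢u (inject≤-injective k≤m k≤m _ _ same)

no-colouring⇒more : ∀ {n} {G : Graph n} {k m} →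
  ¬ InjEdgeColouring G k → InjEdgeColouring G m → k < m
no-colouring⇒more {k = k} {m} none C with m ≤? k
... | yes m≤k = ⊥-elim (none (widen m≤k C))
... | no m≰k = ≰⇒> m≰k

_⊆_ : ∀ {n} → Graph n → Graph n → Set
G ⊆ H = ∀ {u v} → E G u v → E H u v

restrict : ∀ {n} {G H : Graph n} {k} → G ⊆ H → InjEdgeColouring H k → InjEdgeColouring G k
col (restrict G⊆H C) = col C
col-sym (restrict G⊆H C) u v uv = col-sym C u v (G⊆H uv)
col-inj (restrict G⊆H C) x y z u xy yz zu = col-inj C x y z u (G⊆H xy) (G⊆H yz) (G⊆H zu)

index-monotone : ∀ {n} {G H : Graph n} {k l} → G ⊆ H →
  InjChromaticIndex G k → InjChromaticIndex H l → k ≤ l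
index-monotone G⊆H (_ , minimal) (C , _) = minimal _ (restrict G⊆H C)

⊆+edge : ∀ {n} (G : Graph n) x → G ⊆ (G +edge x)
⊆+edge G x uv rewrite uv = refl

module Embedded {n m k} {G : Graph n} (C : InjEdgeColouring G k)
                (f : Fin m → Fin n) (f-inj : Injective _≡_ _≡_ f) where

  κ : Fin m → Fin m → Fin k
  κ i j = col C (f i) (f j)

  κ-sym : ∀ {i j} → E G (f i) (f j) → κ i j ≡ κ j i
  κ-sym = col-sym C _ _

  κ-consecutive : ∀ {x y z u} → E G (f x) (f y) → E G (f y) (f z) → E G (f z) (f u) →
                  x ≢ z → y ≢ u → κ x y ≢ κ z u
  κ-consecutive xy yz zu x≢z y≢u =
    col-inj C _ _ _ _ xy yz zu (λ fx≡fz → x≢z (f-inj fx≡fz)) (λ fy≡fu → y≢u (f-inj fy≡fu))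

other-colour-unique : (a b c : Fin 2) → a ≢ b → a ≢ c → b ≡ c
other-colour-unique fz     fz     _      a≢b _   = ⊥-elim (a≢b refl)
other-colour-unique fz     (fs fz) fz    _   a≢c = ⊥-elim (a≢c refl)
other-colour-unique fz     (fs fz) (fs fz) _ _   = refl
other-colour-unique (fs fz) fz    fz     _   _   = refl
other-colour-unique (fs fz) fz    (fs fz) _  a≢c = ⊥-elim (a≢c refl)
other-colour-unique (fs fz) (fs fz) _    a≢b _   = ⊥-elim (a≢b refl)

-- A graph containing T' has no injective edge colouring with two colours:
-- ab forces cd and cg to share a colour, ef forces cd and dh to share one,
-- but cg and dh are joined by cd and must differ.
T'-not-2-colourable : ∀ {n} (G : Graph n) → ContainsT' G → ¬ InjEdgeColouring G 2
T'-not-2-colourable G (f , f-inj , ab , bc , cd , de , ef , cg , dh) C = cg≢dh cg≡dh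
  where
  open Embedded C f f-inj
  a b c d e f' g h : Fin 8
  a = # 0
  b = # 1
  c = # 2
  d = # 3
  e = # 4
  f' = # 5
  g = # 6
  h = # 7
  cd≡cg : κ c d ≡ κ c g
  cd≡cg = other-colour-unique (κ a b) _ _ (κ-consecutive ab bc cd (λ ()) (λ ()))
                                         (κ-consecutive ab bc cg (λ ()) (λ ()))
  cd≡dh : κ c d ≡ κ d h
  cd≡dh = other-colour-unique (κ e f') _ _
            (λ ef≡cd → κ-consecutive cd de ef (λ ()) (λ ()) (sym ef≡cd))
            (λ ef≡dh → κ-consecutive (E-sym {G = G} dh) de ef (λ ()) (λ ())
                          (trans (sym (κ-sym dh)) (sym ef≡dh)))
  cg≡dh : κ c g ≡ κ d h
  cg≡dh = trans (sym cd≡cg) cd≡dh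
  cg≢dh : κ c g ≢ κ d h
  cg≢dh cg≡dh' = κ-consecutive (E-sym {G = G} cg) cd dh (λ ()) (λ ()) (trans (sym (κ-sym cg)) cg≡dh')

+-%-absorb : ∀ c t p .{{_ : NonZero p}} → (c + t % p) % p ≡ (c + t) % p
+-%-absorb c t p = begin
  (c + t % p) % p           ≡⟨ %-distribˡ-+ c (t % p) p ⟩
  (c % p + t % p % p) % p   ≡⟨ cong (λ r → (c % p + r) % p) (m%n%n≡m%n t p) ⟩
  (c % p + t % p) % p       ≡⟨ sym (%-distribˡ-+ c t p) ⟩
  (c + t) % p               ∎
  where open ≡-Reasoning

two-steps-apart : ∀ p .{{_ : NonZero p}} → 3 ≤ p → ∀ t → t % p ≢ (2 + t) % p
two-steps-apart p 3≤p t same = r≢[2+r]%p (t % p) (m%n<n t p) (trans same (sym (+-%-absorb 2 t p)))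
  where
  r≢[2+r]%p : ∀ r → r < p → r ≢ (2 + r) % p
  r≢[2+r]%p r r<p eq with 2 + r <? p
  ... | yes 2+r<p = m≢1+n+m r (trans eq (m<n⇒m%n≡m 2+r<p))
  ... | no 2+r≮p = <-irrefl (sym p≡2) 3≤p
    where
    p≤2+r : p ≤ 2 + r
    p≤2+r = ≮⇒≥ 2+r≮p
    wrapped<p : 2 + r ∸ p < p
    wrapped<p = m<n+o⇒m∸n<o (2 + r) p (+-mono-< 3≤p r<p)
    r≡wrapped : r ≡ 2 + r ∸ p
    r≡wrapped = begin
      r                   ≡⟨ eq ⟩
      (2 + r) % p         ≡⟨ sym (m≤n⇒[n∸m]%m≡n%m p≤2+r) ⟩
      (2 + r ∸ p) % p     ≡⟨ m<n⇒m%n≡m wrapped<p ⟩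
      2 + r ∸ p           ∎
      where open ≡-Reasoning
    p≡2 : p ≡ 2
    p≡2 = +-cancelˡ-≡ r p 2 (begin
      r + p               ≡⟨ cong (_+ p) r≡wrapped ⟩
      2 + r ∸ p + p       ≡⟨ m∸n+n≡m p≤2+r ⟩
      2 + r               ≡⟨ +-comm 2 r ⟩
      r + 2               ∎)
      where open ≡-Reasoning

flip : Fin 2 → Fin 2
flip fz = fs fz
flip (fs fz) = fz

flip-≢ : ∀ x → x ≢ flip x
flip-≢ fz ()
flip-≢ (fs fz) ()

flip-involutive : ∀ x → flip (flip x) ≡ x
flip-involutive fz = refl
flip-involutive (fs fz) = refl

flips : ℕ → Fin 2 → Fin 2
flips zero x = x
flips (suc j) x = flip (flips j x)

flips-fixed⇒even : ∀ j x → flips j x ≡ x → Σ ℕ λ h → j ≡ h * 2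
flips-fixed⇒even zero x _ = 0 , refl
flips-fixed⇒even (suc zero) x fixed = ⊥-elim (flip-≢ x (sym fixed))
flips-fixed⇒even (suc (suc j)) x fixed
  with flips-fixed⇒even j x (trans (sym (flip-involutive (flips j x))) fixed)
... | h , j≡2h = suc h , cong (λ m → 2 + m) j≡2h

module CycleWalk {n q} {G : Graph n} (f : Fin (suc q) → Fin n) (f-inj : Injective _≡_ _≡_ f)
                 (cycle-edge : ∀ i → E G (f i) (f (sucMod i))) where
  p : ℕ
  p = suc q

  position : ℕ → Fin p
  position t = fromℕ< (m%n<n t p)

  position-suc : ∀ t → sucMod (position t) ≡ position (suc t)
  position-suc t = toℕ-injective (begin
    toℕ (sucMod (position t))    ≡⟨ toℕ-fromℕ< (m%n<n (suc (toℕ (position t))) p) ⟩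
    suc (toℕ (position t)) % p   ≡⟨ cong (λ r → suc r % p) (toℕ-fromℕ< (m%n<n t p)) ⟩
    (1 + t % p) % p              ≡⟨ +-%-absorb 1 t p ⟩
    suc t % p                    ≡⟨ sym (toℕ-fromℕ< (m%n<n (suc t) p)) ⟩
    toℕ (position (suc t))       ∎)
    where open ≡-Reasoning

  vertex : ℕ → Fin n
  vertex t = f (position t)

  walk-edge : ∀ t → E G (vertex t) (vertex (suc t))
  walk-edge t = subst (λ i → E G (vertex t) (f i)) (position-suc t) (cycle-edge (position t))

  vertex-periodic : ∀ t → vertex (p + t) ≡ vertex t
  vertex-periodic t = cong f (toℕ-injective (begin
    toℕ (position (p + t))   ≡⟨ toℕ-fromℕ< (m%n<n (p + t) p) ⟩
    (p + t) % p              ≡⟨ cong (_% p) (+-comm p t) ⟩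
    (t + p) % p              ≡⟨ [m+n]%n≡m%n t p ⟩
    t % p                    ≡⟨ sym (toℕ-fromℕ< (m%n<n t p)) ⟩
    toℕ (position t)         ∎))
    where open ≡-Reasoning

  vertex-injective : ∀ s t → vertex s ≡ vertex t → s % p ≡ t % p
  vertex-injective s t same =
    trans (sym (toℕ-fromℕ< _)) (trans (cong toℕ (f-inj same)) (toℕ-fromℕ< _))

  -- With two colours, the colours of the steps alternate with period two,
  -- and closing up the cycle forces 4 ∣ p.
  module TwoColours (3≤p : 3 ≤ p) (C : InjEdgeColouring G 2) where
    colour : ℕ → Fin 2
    colour t = col C (vertex t) (vertex (suc t))

    colour-alternates : ∀ t → colour (2 + t) ≡ flip (colour t)
    colour-alternates t = other-colour-unique (colour t) _ _ two-apart (flip-≢ (colour t))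
      where
      two-apart : colour t ≢ colour (2 + t)
      two-apart = col-inj C _ _ _ _ (walk-edge t) (walk-edge (1 + t)) (walk-edge (2 + t))
        (λ same → two-steps-apart p 3≤p t (vertex-injective t (2 + t) same))
        (λ same → two-steps-apart p 3≤p (1 + t) (vertex-injective (1 + t) (3 + t) same))

    colour-iterate : ∀ j t → colour (j * 2 + t) ≡ flips j (colour t)
    colour-iterate zero t = refl
    colour-iterate (suc j) t = trans (colour-alternates (j * 2 + t)) (cong flip (colour-iterate j t))

    colour-periodic : ∀ t → colour (p + t) ≡ colour t
    colour-periodic t = cong₂ (col C) (vertex-periodic t)
                                      (trans (cong vertex (sym (+-suc p t))) (vertex-periodic (suc t)))

    returns⇒even : ∀ j → colour (j * 2 + 0) ≡ colour 0 → Σ ℕ λ h → j ≡ h * 2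
    returns⇒even j back = flips-fixed⇒even j (colour 0) (trans (sym (colour-iterate j 0)) back)

    -- Both p double steps and p single steps return to the start, so p = 2h
    -- with h even.
    length-divisible-by-4 : p % 4 ≡ 0
    length-divisible-by-4 with returns⇒even p p-double-steps
      where
      p-double-steps : colour (p * 2 + 0) ≡ colour 0
      p-double-steps = begin
        colour (p * 2 + 0)   ≡⟨ cong colour (trans (+-identityʳ (p * 2)) (*-comm p 2)) ⟩
        colour (p + (p + 0)) ≡⟨ colour-periodic (p + 0) ⟩
        colour (p + 0)       ≡⟨ colour-periodic 0 ⟩
        colour 0             ∎
        where open ≡-Reasoning
    ... | h , p≡2h with returns⇒even h (trans (cong (λ m → colour (m + 0)) (sym p≡2h)) (colour-periodic 0))
    ...   | h' , h≡2h' = begin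
      p % 4                ≡⟨ cong (_% 4) (trans p≡2h (cong (_* 2) h≡2h')) ⟩
      h' * 2 * 2 % 4       ≡⟨ cong (_% 4) (*-assoc h' 2 2) ⟩
      h' * 4 % 4           ≡⟨ m*n%n≡0 h' 4 ⟩
      0                    ∎
      where open ≡-Reasoning

cycle-not-2-colourable : ∀ {n} {G : Graph n} p → 3 ≤ p → p % 4 ≢ 0 → ContainsCycle G p →
                         ¬ InjEdgeColouring G 2
cycle-not-2-colourable (suc q) 3≤p p%4≢0 (f , f-inj , cycle-edge) C =
  p%4≢0 (CycleWalk.TwoColours.length-divisible-by-4 f f-inj cycle-edge 3≤p C)

-- The number of 2-element subsets of a p-element set.
pairCount : ℕ → ℕ
pairCount zero = 0
pairCount (suc p) = p + pairCount p

pairCount-double : ∀ p → pairCount p * 2 ≡ p * (p ∸ 1)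
pairCount-double zero = refl
pairCount-double (suc zero) = refl
pairCount-double (suc (suc q)) = begin
    (suc q + pairCount (suc q)) * 2   ≡⟨ *-distribʳ-+ 2 (suc q) (pairCount (suc q)) ⟩
    suc q * 2 + pairCount (suc q) * 2 ≡⟨ cong (suc q * 2 +_) (pairCount-double (suc q)) ⟩
    suc q * 2 + suc q * q             ≡⟨ sym (*-distribˡ-+ (suc q) 2 q) ⟩
    suc q * (2 + q)                   ≡⟨ *-comm (suc q) (suc (suc q)) ⟩
    suc (suc q) * suc q               ∎
  where open ≡-Reasoning

-- An enumeration of the pairs i < j in Fin p: a pair of Fin (suc p) either
-- has the new top element p as its larger member, or is a pair of Fin p.
pair : ∀ p → Fin (pairCount p) → Fin p × Fin p
pair-step : ∀ p → Fin p ⊎ Fin (pairCount p) → Fin (suc p) × Fin (suc p)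
pair zero ()
pair (suc p) t = pair-step p (splitAt p t)
pair-step p (inj₁ i) = inject₁ i , fromℕ p
pair-step p (inj₂ s) = inject₁ (proj₁ (pair p s)) , inject₁ (proj₂ (pair p s))

pair-ordered : ∀ p t → toℕ (proj₁ (pair p t)) < toℕ (proj₂ (pair p t))
pair-step-ordered : ∀ p t → toℕ (proj₁ (pair-step p t)) < toℕ (proj₂ (pair-step p t))
pair-ordered (suc p) t = pair-step-ordered p (splitAt p t)
pair-step-ordered p (inj₁ i) rewrite toℕ-inject₁ i | toℕ-fromℕ p = toℕ<n i
pair-step-ordered p (inj₂ s)
  rewrite toℕ-inject₁ (proj₁ (pair p s)) | toℕ-inject₁ (proj₂ (pair p s)) = pair-ordered p s

lifted≢top : ∀ {p} {i : Fin p} → inject₁ i ≢ fromℕ p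
lifted≢top {p} {i} eq =
  <-irrefl (trans (sym (toℕ-inject₁ i)) (trans (cong toℕ eq) (toℕ-fromℕ p))) (toℕ<n i)

pair-injective : ∀ p → Injective _≡_ _≡_ (pair p)
pair-step-injective : ∀ p → Injective _≡_ _≡_ (pair-step p)
pair-injective (suc p) {t} {t'} same = begin
    t                        ≡⟨ sym (join-splitAt p (pairCount p) t) ⟩
    join p _ (splitAt p t)   ≡⟨ cong (join p _) (pair-step-injective p same) ⟩
    join p _ (splitAt p t')  ≡⟨ join-splitAt p (pairCount p) t' ⟩
    t'                       ∎
  where open ≡-Reasoning
pair-step-injective p {inj₁ i} {inj₁ i'} same = cong inj₁ (inject₁-injective (cong proj₁ same))
pair-step-injective p {inj₁ i} {inj₂ s} same = ⊥-elim (lifted≢top (sym (cong proj₂ same)))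
pair-step-injective p {inj₂ s} {inj₁ i} same = ⊥-elim (lifted≢top (cong proj₂ same))
pair-step-injective p {inj₂ s} {inj₂ s'} same =
  cong inj₂ (pair-injective p (cong₂ _,_ (inject₁-injective (cong proj₁ same))
                                         (inject₁-injective (cong proj₂ same))))

-- In a complete subgraph any two distinct edges ij, i'j' get distinct
-- colours: whether they share a vertex or not, some third edge of the
-- clique makes them the ends of three consecutive edges.
module Clique {n p k} {G : Graph n} (C : InjEdgeColouring G k)
              (f : Fin p → Fin n) (f-inj : Injective _≡_ _≡_ f)
              (complete : ∀ i j → i ≢ j → E G (f i) (f j)) where
  open Embedded C f f-inj

  private
    path₃ : ∀ x y z u → x ≢ y → y ≢ z → z ≢ u → x ≢ z → y ≢ u → κ x y ≢ κ z u
    path₃ x y z u x≢y y≢z z≢u =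
      κ-consecutive (complete x y x≢y) (complete y z y≢z) (complete z u z≢u)

    flipped : ∀ {i j} → i ≢ j → κ i j ≡ κ j i
    flipped i≢j = κ-sym (complete _ _ i≢j)

  distinct-edges : ∀ i j i' j' → i ≢ j → i' ≢ j' →
    ¬ (i ≡ i' × j ≡ j') → ¬ (i ≡ j' × j ≡ i') → κ i j ≢ κ i' j'
  distinct-edges i j i' j' i≢j i'≢j' not-same not-swapped same-colour
    with i ≟F i' | i ≟F j' | j ≟F i' | j ≟F j'
  ... | yes refl | _ | _ | yes refl = not-same (refl , refl)
  ... | yes refl | _ | _ | no j≢j' =
    path₃ i j j' i i≢j j≢j' (≢-sym i'≢j') i'≢j' (≢-sym i≢j)
      (trans same-colour (flipped i'≢j'))
  ... | no _ | yes refl | yes refl | _ = not-swapped (refl , refl)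
  ... | no i≢i' | yes refl | no j≢i' | _ =
    path₃ i j i' i i≢j j≢i' i'≢j' i≢i' (≢-sym i≢j) same-colour
  ... | no i≢i' | no i≢j' | yes refl | _ =
    path₃ j i j' j (≢-sym i≢j) i≢j' (≢-sym i'≢j') i'≢j' i≢j
      (trans (sym (flipped i≢j)) (trans same-colour (flipped i'≢j')))
  ... | no i≢i' | no i≢j' | no j≢i' | yes refl =
    path₃ j i i' j (≢-sym i≢j) i≢i' i'≢j' j≢i' i≢j
      (trans (sym (flipped i≢j)) same-colour)
  ... | no i≢i' | no i≢j' | no j≢i' | no j≢j' =
    path₃ i j i' j' i≢j j≢i' i'≢j' i≢i' j≢j' same-colour

  pair-colour : Fin (pairCount p) → Fin k
  pair-colour t = κ (proj₁ (pair p t)) (proj₂ (pair p t))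

  pair-colour-injective : Injective _≡_ _≡_ pair-colour
  pair-colour-injective {t} {t'} same-colour
    with proj₁ (pair p t) ≟F proj₁ (pair p t') ×-dec proj₂ (pair p t) ≟F proj₂ (pair p t')
  ... | yes (≡₁ , ≡₂) = pair-injective p (cong₂ _,_ ≡₁ ≡₂)
  ... | no not-same = ⊥-elim (distinct-edges _ _ _ _ (ordered⇒distinct t) (ordered⇒distinct t')
                                not-same not-swapped same-colour)
    where
    ordered⇒distinct : ∀ t → proj₁ (pair p t) ≢ proj₂ (pair p t)
    ordered⇒distinct t eq = <-irrefl (cong toℕ eq) (pair-ordered p t)
    not-swapped : ¬ (proj₁ (pair p t) ≡ proj₂ (pair p t') × proj₂ (pair p t) ≡ proj₁ (pair p t'))
    not-swapped (≡₁ , ≡₂) =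
      <-asym (subst₂ _<_ (cong toℕ ≡₁) (cong toℕ ≡₂) (pair-ordered p t)) (pair-ordered p t')

clique-bound : ∀ {n} {G : Graph n} p → ContainsComplete G p →
               ∀ {k} → InjEdgeColouring G k → p * (p ∸ 1) / 2 ≤ k
clique-bound p (f , f-inj , complete) {k} C =
  subst (_≤ k) half (injective⇒≤ (Clique.pair-colour-injective C f f-inj complete))
  where
  half : pairCount p ≡ p * (p ∸ 1) / 2
  half = trans (sym (m*n/n≡m (pairCount p) 2)) (cong (_/ 2) (pairCount-double p))

Least : (ℕ → Set) → ℕ → Set
Least P k = P k × (∀ j → j < k → ¬ P j)

-- Least number principle for decidable predicates on ℕ.  It is opaque since
-- only its specification is used, and unfolding it makes type checking slow.
opaque
  least : (P : ℕ → Set) → (∀ k → Dec (P k)) → ∀ {K} → P K → Σ ℕ (Least P)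
  least P P? {K} = <-rec (λ K → P K → Σ ℕ (Least P)) search K
    where
    search : ∀ K → (∀ {j} → j < K → P j → Σ ℕ (Least P)) → P K → Σ ℕ (Least P)
    search K smaller PK with anyUpTo? P? K
    ... | yes (j , j<K , Pj) = smaller j<K Pj
    ... | no none = K , PK , λ j j<K Pj → none (j , j<K , Pj)

sucMod-step : ∀ {q} (t : Fin (suc q)) →
  (toℕ t < q × toℕ (sucMod t) ≡ suc (toℕ t)) ⊎ (toℕ t ≡ q × toℕ (sucMod t) ≡ 0)
sucMod-step {q} t with toℕ t <? q
... | yes t<q = inj₁ (t<q , trans (toℕ-fromℕ< _) (m<n⇒m%n≡m (s≤s t<q)))
... | no t≮q =
  inj₂ (t≡q , trans (toℕ-fromℕ< _) (trans (cong (λ r → suc r % suc q) t≡q) (n%n≡0 (suc q))))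
  where
  t≡q : toℕ t ≡ q
  t≡q = ≤-antisym (s≤s⁻¹ (toℕ<n t)) (≮⇒≥ t≮q)

-- A closed walk w 0, …, w m that never immediately returns to the vertex
-- it came from contains a cycle: cut it at the first revisited vertex.
module ClosedWalk {n} {G : Graph n} (w : ℕ → Fin n) (m : ℕ)
                  (walk-edge : ∀ i → i < m → E G (w i) (w (suc i)))
                  (no-backtrack : ∀ i → 2 + i ≤ m → w i ≢ w (2 + i)) where

  Revisit : ℕ → Set
  Revisit J = Σ ℕ λ i → i < J × w i ≡ w J

  revisit? : ∀ J → Dec (Revisit J)
  revisit? J = anyUpTo? (λ i → w i ≟F w J) J

  distinct-before : ∀ {J} → (∀ j → j < J → ¬ Revisit j) →
                    ∀ a b → a < J → b < J → w a ≡ w b → a ≡ b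
  distinct-before first a b a<J b<J same with <-cmp a b
  ... | tri< a<b _ _ = ⊥-elim (first b b<J (a , a<b , same))
  ... | tri≈ _ a≡b _ = a≡b
  ... | tri> _ _ b<a = ⊥-elim (first a a<J (b , b<a , sym same))

  segment-cycle : ∀ i q → suc i + q ≤ m → w (suc i + q) ≡ w i →
                  (∀ a b → a < suc q → b < suc q → w (i + a) ≡ w (i + b) → a ≡ b) →
                  ContainsCycle G (suc q)
  segment-cycle i q fits closes distinct = F , F-injective , F-edge
    where
    F : Fin (suc q) → Fin n
    F t = w (i + toℕ t)
    F-injective : Injective _≡_ _≡_ F
    F-injective {s} {t} same = toℕ-injective (distinct _ _ (toℕ<n s) (toℕ<n t) same)
    next : ∀ t → F (sucMod t) ≡ w (suc (i + toℕ t))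
    next t with sucMod-step t
    ... | inj₁ (_ , increments) = cong w (trans (cong (i +_) increments) (+-suc i (toℕ t)))
    ... | inj₂ (last , wrap) = begin
      w (i + toℕ (sucMod t)) ≡⟨ cong (λ r → w (i + r)) wrap ⟩
      w (i + 0)              ≡⟨ cong w (+-identityʳ i) ⟩
      w i                    ≡⟨ sym closes ⟩
      w (suc i + q)          ≡⟨ cong (λ r → w (suc i + r)) (sym last) ⟩
      w (suc (i + toℕ t))    ∎
      where open ≡-Reasoning
    F-edge : ∀ t → E G (F t) (F (sucMod t))
    F-edge t = subst (E G (F t)) (sym (next t))
      (walk-edge (i + toℕ t) (≤-trans (s≤s (+-monoʳ-≤ i (s≤s⁻¹ (toℕ<n t)))) fits))

  first-revisit : 0 < m → w 0 ≡ w m → Σ ℕ λ J → Least Revisit J × J ≤ m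
  first-revisit 0<m closed with least Revisit revisit? (0 , 0<m , closed)
  ... | J , (revisit , first) = J , (revisit , first) , ≮⇒≥ λ m<J → first m m<J (0 , 0<m , closed)

  -- Revisiting after one step is a loop, after two steps a backtrack;
  -- so the first revisit closes a cycle of length at least 3.
  closed-walk⇒cycle : 0 < m → w 0 ≡ w m → Σ ℕ λ p → 3 ≤ p × ContainsCycle G p
  closed-walk⇒cycle 0<m closed with first-revisit 0<m closed
  ... | J , ((i , i<J , repeat) , first) , J≤m with m≤n⇒∃[o]m+o≡n i<J
  ... | zero , refl =
    ⊥-elim (adjacent⇒distinct {G = G} (walk-edge i (subst (_≤ m) (+-identityʳ (suc i)) J≤m))
                                       (trans repeat (cong w (+-identityʳ (suc i)))))
  ... | suc zero , refl =
    ⊥-elim (no-backtrack i (subst (_≤ m) J≡2+i J≤m) (trans repeat (cong w J≡2+i)))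
    where
    J≡2+i : suc i + 1 ≡ 2 + i
    J≡2+i = cong suc (+-comm i 1)
  ... | suc (suc r) , refl =
    3 + r , s≤s (s≤s (s≤s z≤n)) , segment-cycle i (2 + r) J≤m (sym repeat) distinct
    where
    within : ∀ a → a < 3 + r → i + a < suc i + (2 + r)
    within a a<3+r = s≤s (+-monoʳ-≤ i (s≤s⁻¹ a<3+r))
    distinct : ∀ a b → a < 3 + r → b < 3 + r → w (i + a) ≡ w (i + b) → a ≡ b
    distinct a b a< b< same =
      +-cancelˡ-≡ i a b (distinct-before first (i + a) (i + b) (within a a<) (within b b<) same)

rotate : Fin 3 → Fin 3
rotate fz = fs fz
rotate (fs fz) = fs (fs fz)
rotate (fs (fs fz)) = fz

layer-colour : ℕ → Fin 3
layer-colour zero = fz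
layer-colour (suc k) = rotate (layer-colour k)

layer-colour-apart : ∀ {a b} → b ≡ 1 + a ⊎ b ≡ 2 + a → layer-colour a ≢ layer-colour b
layer-colour-apart {a} (inj₁ refl) = rotate-moves (layer-colour a)
  where
  rotate-moves : ∀ x → x ≢ rotate x
  rotate-moves fz ()
  rotate-moves (fs fz) ()
  rotate-moves (fs (fs fz)) ()
layer-colour-apart {a} (inj₂ refl) = rotate²-moves (layer-colour a)
  where
  rotate²-moves : ∀ x → x ≢ rotate (rotate x)
  rotate²-moves fz ()
  rotate²-moves (fs fz) ()
  rotate²-moves (fs (fs fz)) ()

module BreadthFirst {n} (G : Graph n) (connected : Connected G) (r : Fin n) where

  Within : ℕ → Fin n → Set
  Within zero v = v ≡ r
  Within (suc k) v = Within k v ⊎ Σ (Fin n) λ u → Within k u × E G u v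

  within? : ∀ k v → Dec (Within k v)
  within? zero v = v ≟F r
  within? (suc k) v with within? k v
  ... | yes near = yes (inj₁ near)
  ... | no far with any? (λ u → within? k u ×-dec (adj G u v ≟B true))
  ...   | yes (u , near , uv) = yes (inj₂ (u , near , uv))
  ...   | no none = no λ { (inj₁ near) → far near ; (inj₂ (u , near , uv)) → none (u , near , uv) }

  reach⇒within : ∀ {v} → Reach G r v → Σ ℕ λ k → Within k v
  reach⇒within here = 0 , refl
  reach⇒within (step walk uv) with reach⇒within walk
  ... | k , near = suc k , inj₂ (_ , near , uv)

  least-layer : ∀ v → Σ ℕ (Least λ k → Within k v)
  least-layer v = least (λ k → Within k v) (λ k → within? k v) (proj₂ (reach⇒within (connected r v)))

  dist : Fin n → ℕ
  dist v = proj₁ (least-layer v)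

  dist-within : ∀ v → Within (dist v) v
  dist-within v = proj₁ (proj₂ (least-layer v))

  dist-least : ∀ v j → Within j v → dist v ≤ j
  dist-least v j near = ≮⇒≥ λ j<dist → proj₂ (proj₂ (least-layer v)) j j<dist near

  dist-root : ∀ v → dist v ≡ 0 → v ≡ r
  dist-root v d≡0 = subst (λ k → Within k v) d≡0 (dist-within v)

  dist-edge : ∀ {u v} → E G u v → dist v ≤ suc (dist u)
  dist-edge {u} {v} uv = dist-least v (suc (dist u)) (inj₂ (u , dist-within u , uv))

  parent : ∀ v k → dist v ≡ suc k → Σ (Fin n) λ u → dist u ≡ k × E G u v
  parent v k dv with subst (λ j → Within j v) dv (dist-within v)
  ... | inj₁ near = ⊥-elim (<-irrefl refl (subst (_≤ k) dv (dist-least v k near)))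
  ... | inj₂ (u , near , uv) =
    u , ≤-antisym (dist-least u k near) (s≤s⁻¹ (subst (_≤ suc (dist u)) dv (dist-edge uv))) , uv

  record RootPath (v : Fin n) : Set where
    field
      at      : ℕ → Fin n
      at-end  : at (dist v) ≡ v
      at-dist : ∀ i → i ≤ dist v → dist (at i) ≡ i
      at-edge : ∀ i → i < dist v → E G (at i) (at (suc i))
  open RootPath public

  extend : ∀ {u v k} → dist u ≡ k → dist v ≡ suc k → E G u v → RootPath u → RootPath v
  extend {u} {v} {k} du dv uv P = record
    { at = at′ ; at-end = subst (λ i → at′ i ≡ v) (sym dv) at′-top
    ; at-dist = at′-dist ; at-edge = at′-edge }
    where
    at′ : ℕ → Fin n
    at′ i with i ≤? k
    ... | yes _ = at P i
    ... | no _ = v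
    at′-low : ∀ i → i ≤ k → at′ i ≡ at P i
    at′-low i i≤k with i ≤? k
    ... | yes _ = refl
    ... | no i≰k = ⊥-elim (i≰k i≤k)
    at′-top : at′ (suc k) ≡ v
    at′-top with suc k ≤? k
    ... | yes k<k = ⊥-elim (<-irrefl refl k<k)
    ... | no _ = refl
    at-u : at P k ≡ u
    at-u = subst (λ i → at P i ≡ u) du (at-end P)
    at′-dist : ∀ i → i ≤ dist v → dist (at′ i) ≡ i
    at′-dist i i≤dv with m≤n⇒m<n∨m≡n (subst (i ≤_) dv i≤dv)
    ... | inj₁ i<1+k = trans (cong dist (at′-low i (s≤s⁻¹ i<1+k)))
                             (at-dist P i (subst (i ≤_) (sym du) (s≤s⁻¹ i<1+k)))
    ... | inj₂ refl = trans (cong dist at′-top) dv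
    at′-edge : ∀ i → i < dist v → E G (at′ i) (at′ (suc i))
    at′-edge i i<dv with m≤n⇒m<n∨m≡n (s≤s⁻¹ (subst (i <_) dv i<dv))
    ... | inj₁ i<k = subst₂ (E G) (sym (at′-low i (<⇒≤ i<k))) (sym (at′-low (suc i) i<k))
                       (at-edge P i (subst (i <_) (sym du) i<k))
    ... | inj₂ refl = subst₂ (E G) (sym (trans (at′-low i ≤-refl) at-u)) (sym at′-top) uv

  root-path-at : ∀ k v → dist v ≡ k → RootPath v
  root-path-at zero v dv = record
    { at = λ _ → v ; at-end = refl
    ; at-dist = λ i i≤dv → trans dv (sym (n≤0⇒n≡0 (subst (i ≤_) dv i≤dv)))
    ; at-edge = λ i i<dv → ⊥-elim (n≮0 (subst (i <_) dv i<dv)) }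
  root-path-at (suc k) v dv with parent v k dv
  ... | u , du , uv = extend du dv uv (root-path-at k u du)

  root-path : ∀ v → RootPath v
  root-path v = root-path-at (dist v) v refl

  root-path-start : ∀ v → at (root-path v) 0 ≡ r
  root-path-start v = dist-root _ (at-dist (root-path v) 0 z≤n)

  module Acyclic (acyclic : ∀ p → p ≥ 3 → ¬ ContainsCycle G p) where

    -- An edge ab that is not the last edge of the root path of b, although
    -- b lies at least as deep as a.
    NonTreeEdge : Fin n → Fin n → Set
    NonTreeEdge a b = dist b ≡ dist a ⊎ (dist b ≡ suc (dist a) × a ≢ at (root-path b) (dist a))

    -- Such an edge closes the walk r → a → b → r (along root paths) without
    -- backtracking: walk i is the root path of a for i ≤ dist a, and then
    -- the root path of b traversed backwards.
    module Detour {a b} (ab : E G a b) (nontree : NonTreeEdge a b) where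
      da db m : ℕ
      da = dist a
      db = dist b
      m = suc (da + db)

      da≤db : da ≤ db
      da≤db = no-higher nontree
        where
        no-higher : NonTreeEdge a b → da ≤ db
        no-higher (inj₁ db≡da) = ≤-reflexive (sym db≡da)
        no-higher (inj₂ (db≡1+da , _)) = subst (da ≤_) (sym db≡1+da) (n≤1+n da)

      Pa Pb : ℕ → Fin n
      Pa = at (root-path a)
      Pb = at (root-path b)

      walk : ℕ → Fin n
      walk i with i ≤? da
      ... | yes _ = Pa i
      ... | no _ = Pb (m ∸ i)

      walk-up : ∀ i → i ≤ da → walk i ≡ Pa i
      walk-up i i≤da with i ≤? da
      ... | yes _ = refl
      ... | no i≰da = ⊥-elim (i≰da i≤da)

      walk-down : ∀ j → walk (suc da + j) ≡ Pb (db ∸ j)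
      walk-down j with suc da + j ≤? da
      ... | yes da<da = ⊥-elim (<-irrefl refl (m+n≤o⇒m≤o (suc da) da<da))
      ... | no _ = cong Pb ([m+n]∸[m+o]≡n∸o da db j)

      height-up : ∀ i → i ≤ da → dist (walk i) ≡ i
      height-up i i≤da = trans (cong dist (walk-up i i≤da)) (at-dist (root-path a) i i≤da)

      height-down : ∀ j → dist (walk (suc da + j)) ≡ db ∸ j
      height-down j = trans (cong dist (walk-down j)) (at-dist (root-path b) (db ∸ j) (m∸n≤m db j))

      walk-a : walk da ≡ a
      walk-a = trans (walk-up da ≤-refl) (at-end (root-path a))

      walk-b : walk (suc da) ≡ b
      walk-b = trans (cong walk (cong suc (sym (+-identityʳ da))))
                     (trans (walk-down 0) (at-end (root-path b)))

      down-edge : ∀ j → suc j ≤ db → E G (Pb (db ∸ j)) (Pb (db ∸ suc j))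
      down-edge j j<db = subst (λ i → E G (Pb i) (Pb (db ∸ suc j))) (sym db∸j≡1+x)
                           (E-sym {G = G} (at-edge (root-path b) (db ∸ suc j) x<db))
        where
        db∸j≡1+x : db ∸ j ≡ suc (db ∸ suc j)
        db∸j≡1+x = +-∸-assoc 1 j<db
        x<db : db ∸ suc j < db
        x<db = subst (_≤ db) db∸j≡1+x (m∸n≤m db j)

      walk-edge : ∀ i → i < m → E G (walk i) (walk (suc i))
      walk-edge i i<m with <-cmp i da
      ... | tri< i<da _ _ = subst₂ (E G) (sym (walk-up i (<⇒≤ i<da))) (sym (walk-up (suc i) i<da))
                              (at-edge (root-path a) i i<da)
      ... | tri≈ _ refl _ = subst₂ (E G) (sym walk-a) (sym walk-b) ab
      ... | tri> _ _ da<i with m≤n⇒∃[o]m+o≡n da<i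
      ...   | j , refl = subst₂ (E G) (sym (walk-down j))
                           (sym (trans (cong walk (sym (+-suc (suc da) j))) (walk-down (suc j))))
                           (down-edge j (+-cancelˡ-≤ da (suc j) db
                             (subst (_≤ da + db) (sym (+-suc da j)) (s≤s⁻¹ i<m))))

      closes : walk 0 ≡ walk m
      closes = begin
        walk 0                 ≡⟨ walk-up 0 z≤n ⟩
        Pa 0                   ≡⟨ root-path-start a ⟩
        r                      ≡⟨ sym (root-path-start b) ⟩
        Pb 0                   ≡⟨ cong Pb (sym (n∸n≡0 db)) ⟩
        Pb (db ∸ db)           ≡⟨ sym (walk-down db) ⟩
        walk m                 ∎
        where open ≡-Reasoning

      -- Walking up a root path the layer grows at every step.
      ascending-apart : ∀ i → 2 + i ≤ da → walk i ≢ walk (2 + i)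
      ascending-apart i 2+i≤da same = m≢1+n+m i (begin
        i                    ≡⟨ sym (height-up i (≤-trans (n≤1+n i) (<⇒≤ 2+i≤da))) ⟩
        dist (walk i)        ≡⟨ cong dist same ⟩
        dist (walk (2 + i))  ≡⟨ height-up (2 + i) 2+i≤da ⟩
        2 + i                ∎)
        where open ≡-Reasoning

      -- The vertex before a lies above a, while b lies no higher than a.
      before-a-apart : ∀ i → suc i ≡ da → walk i ≢ walk (2 + i)
      before-a-apart i 1+i≡da same = <-irrefl i≡db (≤-trans (≤-reflexive 1+i≡da) da≤db)
        where
        i≡db : i ≡ db
        i≡db = begin
          i                    ≡⟨ sym (height-up i (subst (i ≤_) 1+i≡da (n≤1+n i))) ⟩
          dist (walk i)        ≡⟨ cong dist same ⟩
          dist (walk (2 + i))  ≡⟨ cong (λ k → dist (walk (suc k))) 1+i≡da ⟩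
          dist (walk (suc da)) ≡⟨ cong dist walk-b ⟩
          db                   ∎
          where open ≡-Reasoning

      -- After a, b the walk does not return to a: either b lies in the layer
      -- of a, or a is not the vertex above b on the root path of b.
      turn-apart : 2 + da ≤ m → walk da ≢ walk (2 + da)
      turn-apart fits same = turn nontree
        where
        a≡Pb[db∸1] : a ≡ Pb (db ∸ 1)
        a≡Pb[db∸1] = trans (sym walk-a) (trans same (trans (cong walk (cong suc (+-comm 1 da))) (walk-down 1)))
        1≤db : 1 ≤ db
        1≤db = +-cancelˡ-≤ da 1 db (subst (_≤ da + db) (+-comm 1 da) (s≤s⁻¹ fits))
        turn : NonTreeEdge a b → ⊥
        turn (inj₂ (db≡1+da , a≢Pb[da])) =
          a≢Pb[da] (trans a≡Pb[db∸1] (cong (λ k → Pb (k ∸ 1)) db≡1+da))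
        turn (inj₁ db≡da) = <-irrefl (begin
            db ∸ 1                   ≡⟨ sym (height-down 1) ⟩
            dist (walk (suc da + 1)) ≡⟨ cong dist (walk-down 1) ⟩
            dist (Pb (db ∸ 1))       ≡⟨ cong dist (sym a≡Pb[db∸1]) ⟩
            da                       ≡⟨ sym db≡da ⟩
            db                       ∎) (∸-monoʳ-< z<s 1≤db)
          where open ≡-Reasoning

      -- Walking down the root path of b the layer shrinks at every step.
      descending-apart : ∀ j → 2 + (suc da + j) ≤ m → walk (suc da + j) ≢ walk (2 + (suc da + j))
      descending-apart j fits same = m≢1+n+m j (∸-cancelˡ-≡ (m+n≤o⇒n≤o 2 2+j≤db) 2+j≤db (begin
          db ∸ j                         ≡⟨ sym (height-down j) ⟩
          dist (walk (suc da + j))       ≡⟨ cong dist same ⟩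
          dist (walk (2 + (suc da + j))) ≡⟨ cong (λ k → dist (walk k)) shift ⟩
          dist (walk (suc da + (2 + j))) ≡⟨ height-down (2 + j) ⟩
          db ∸ (2 + j)                   ∎))
        where
        open ≡-Reasoning
        shift : 2 + (suc da + j) ≡ suc da + (2 + j)
        shift = sym (trans (+-suc (suc da) (suc j)) (cong suc (+-suc (suc da) j)))
        2+j≤db : 2 + j ≤ db
        2+j≤db = +-cancelˡ-≤ da (2 + j) db
                   (subst (_≤ da + db) (sym (trans (+-suc da (suc j)) (cong suc (+-suc da j))))
                          (s≤s⁻¹ fits))

      no-backtrack : ∀ i → 2 + i ≤ m → walk i ≢ walk (2 + i)
      no-backtrack i fits with <-cmp (suc i) da
      ... | tri< 2+i≤da _ _ = ascending-apart i 2+i≤da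
      ... | tri≈ _ 1+i≡da _ = before-a-apart i 1+i≡da
      ... | tri> _ _ da<1+i with m≤n⇒m<n∨m≡n (s≤s⁻¹ da<1+i)
      ...   | inj₂ refl = turn-apart fits
      ...   | inj₁ da<i with m≤n⇒∃[o]m+o≡n da<i
      ...     | j , refl = descending-apart j fits

      cycle : Σ ℕ λ p → 3 ≤ p × ContainsCycle G p
      cycle = ClosedWalk.closed-walk⇒cycle {G = G} walk m walk-edge no-backtrack (s≤s z≤n) closes

    no-non-tree-edge : ∀ {a b} → E G a b → ¬ NonTreeEdge a b
    no-non-tree-edge ab nontree = contradiction (Detour.cycle ab nontree)
      where
      contradiction : (Σ ℕ λ p → 3 ≤ p × ContainsCycle G p) → ⊥
      contradiction (p , 3≤p , cycle) = acyclic p 3≤p cycle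

    _↓_ : Fin n → Fin n → Set
    u ↓ v = dist v ≡ suc (dist u)

    edge-layers : ∀ {u v} → E G u v → u ↓ v ⊎ v ↓ u
    edge-layers {u} {v} uv
      with m≤n⇒m<n∨m≡n (dist-edge uv) | m≤n⇒m<n∨m≡n (dist-edge (E-sym {G = G} uv))
    ... | inj₂ down | _ = inj₁ down
    ... | inj₁ _ | inj₂ up = inj₂ up
    ... | inj₁ v≤u | inj₁ u≤v =
      ⊥-elim (no-non-tree-edge uv (inj₁ (≤-antisym (s≤s⁻¹ v≤u) (s≤s⁻¹ u≤v))))

    unique-parent : ∀ {x y z} → E G x y → E G z y → x ↓ y → z ↓ y → x ≡ z
    unique-parent {x} {y} {z} xy zy x↓y z↓y with x ≟F z
    ... | yes x≡z = x≡z
    ... | no x≢z with x ≟F at (root-path y) (dist x)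
    ...   | no x-off-path = ⊥-elim (no-non-tree-edge xy (inj₂ (x↓y , x-off-path)))
    ...   | yes x-on-path = ⊥-elim (no-non-tree-edge zy (inj₂ (z↓y , z-off-path)))
      where
      same-layer : dist z ≡ dist x
      same-layer = suc-injective (trans (sym z↓y) x↓y)
      z-off-path : z ≢ at (root-path y) (dist z)
      z-off-path z-on-path =
        x≢z (trans x-on-path (trans (cong (at (root-path y)) (sym same-layer)) (sym z-on-path)))

    deeper-right : ∀ {u v} → u ↓ v → dist u ⊔ dist v ≡ dist v
    deeper-right u↓v = m≤n⇒m⊔n≡n (subst (_ ≤_) (sym u↓v) (n≤1+n _))

    deeper-left : ∀ {u v} → v ↓ u → dist u ⊔ dist v ≡ dist u
    deeper-left v↓u = m≥n⇒m⊔n≡m (subst (_ ≤_) (sym v↓u) (n≤1+n _))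

    outer : ∀ {x y z u a b} → layer-colour (dist x ⊔ dist y) ≡ layer-colour (dist z ⊔ dist u) →
            dist x ⊔ dist y ≡ a → dist z ⊔ dist u ≡ b → layer-colour a ≡ layer-colour b
    outer same deeper-xy deeper-zu =
      trans (sym (cong layer-colour deeper-xy)) (trans same (cong layer-colour deeper-zu))

    -- Three consecutive
    -- edges can neither go down to a common vertex (unique parents), so
    -- the deeper ends of the outer two edges are one or two layers apart.
    layer-colouring : InjEdgeColouring G 3
    col layer-colouring u v = layer-colour (dist u ⊔ dist v)
    col-sym layer-colouring u v _ = cong layer-colour (⊔-comm (dist u) (dist v))
    col-inj layer-colouring x y z u xy yz zu x≢z y≢u same
      with edge-layers xy | edge-layers yz | edge-layers zu
    ... | inj₁ x↓y | inj₁ y↓z | inj₁ z↓u =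
      layer-colour-apart (inj₂ (trans z↓u (cong suc y↓z)))
        (outer same (deeper-right x↓y) (deeper-right z↓u))
    ... | inj₁ x↓y | inj₁ y↓z | inj₂ u↓z = y≢u (unique-parent yz (E-sym {G = G} zu) y↓z u↓z)
    ... | inj₁ x↓y | inj₂ z↓y | _ = x≢z (unique-parent xy (E-sym {G = G} yz) x↓y z↓y)
    ... | inj₂ y↓x | inj₁ y↓z | inj₁ z↓u =
      layer-colour-apart (inj₁ (trans z↓u (cong suc (trans y↓z (sym y↓x)))))
        (outer same (deeper-left y↓x) (deeper-right z↓u))
    ... | inj₂ y↓x | inj₁ y↓z | inj₂ u↓z = y≢u (unique-parent yz (E-sym {G = G} zu) y↓z u↓z)
    ... | inj₂ y↓x | inj₂ z↓y | inj₁ z↓u =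
      layer-colour-apart (inj₁ (trans y↓x (cong suc (trans z↓y (sym z↓u)))))
        (sym (outer same (deeper-left y↓x) (deeper-right z↓u)))
    ... | inj₂ y↓x | inj₂ z↓y | inj₂ u↓z =
      layer-colour-apart (inj₂ (trans y↓x (cong suc z↓y)))
        (sym (outer same (deeper-left y↓x) (deeper-left u↓z)))

tree-3-colourable : ∀ {n} (G : Graph n) → IsTree G → InjEdgeColouring G 3
tree-3-colourable {zero} G _ = record { col = λ () ; col-sym = λ () ; col-inj = λ () }
tree-3-colourable {suc n} G (connected , acyclic) =
  BreadthFirst.Acyclic.layer-colouring G connected fz acyclic

corollary2 : ∀ (n : ℕ) (G : Graph n) → Connected G →
    (∀ (a b : Fin n) (a≢b : a ≢ b) → adj G a b ≡ false →
       ∀ k l → InjChromaticIndex G k → InjChromaticIndex (G +edge ((a , b) , a≢b)) l → k ≤ l)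
  × (∀ p → p ≥ 4 → p % 4 ≢ 0 → ContainsCycle G p →
       ∀ k → InjChromaticIndex G k → k ≥ 3)
  × (∀ p → ContainsComplete G p →
       ∀ k → InjChromaticIndex G k → k ≥ (p * (p ∸ 1)) / 2)
  × (ContainsT' G → ∀ k → InjChromaticIndex G k → k ≥ 3)
  × (IsTree G → ContainsT' G → InjChromaticIndex G 3)
corollary2 n G _ =
  (λ a b a≢b _ k l → index-monotone (⊆+edge G ((a , b) , a≢b))) ,
  (λ p 4≤p p%4≢0 cycle k (C , _) →
     no-colouring⇒more (cycle-not-2-colourable p (≤-trans (n≤1+n 3) 4≤p) p%4≢0 cycle) C) ,
  (λ p clique k (C , _) → clique-bound p clique C) ,
  (λ contains-T' k (C , _) → no-colouring⇒more (T'-not-2-colourable G contains-T') C) ,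
  (λ tree contains-T' → tree-3-colourable G tree ,
     λ m C → no-colouring⇒more (T'-not-2-colourable G contains-T') C)
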